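{- Let $f:\mathbb{N}\to\mathbb{N}$ be a surjective function with $f(1)=1$, $2\leq f(n)\leq n$ for all $n\geq 2$, and $|f^{ -1}(n)|=\infty$ for all $n\geq 2$, and let $X=\bigsqcup_{n\ge1}X_n$, $Y=\bigsqcup_{n\ge1}Y_n$ be as defined in the context. Let $n\geq 2$ (equivalently $f(n)\geq 2$) and set $|X_n|=\big(2^{2^{2n}}f(n)+1\big)f(n)$. Then every subgraph of $X$ with at most $|X_n|$ vertices admits a coarse $f(n)$-wiring into $Y$ with volume at most $2|X_n|$. Hence \[ \mathrm{wir}^{f(n)}_{X\to Y}(|X_n|)\leq 2|X_n|. \]
   Context: For $n\in\mathbb{N}$, $X_n$ is the graph with vertex set $\{0,1,\dots,f(n)-1\}\times\{0,1,\dots,2^{2^{2n}}f(n)\}$, with an edge between $(i,j)$ and $(i,j+1)$ for all $i$ and all $0\le j\le 2^{2^{2n}}f(n)-1$, and an edge between $(i,j)$ and $(i+1,j)$ whenever $0\le i\le f(n)-2$ and $j=2^{2^{2n}}m$ for some integer $m\geq 0$. $Y_n$ is defined identically with $2^{2^{2n}}$ replaced by $2^{2^{2n+1}}$ throughout: vertex set $\{0,\dots,f(n)-1\}\times\{0,\dots,2^{2^{2n+1}}f(n)\}$, all vertical edges $(i,j)(i,j+1)$, and horizontal edges $(i,j)(i+1,j)$ for $j$ a nonnegative integer multiple of $2^{2^{2n+1}}$. $X$ (resp. $Y$) is the disjoint union of the $X_n$ (resp. $Y_n$), $n\ge1$. A wiring of a finite graph $\Gamma$ into a graph $Y$ is a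 continuous map $g:\Gamma\to Y$ mapping vertices to vertices and edges to unions of edges; the image of each edge $e$ is a path $P_e$ in $Y$ (possibly a single vertex) joining the images of its endpoints. It is a coarse $k$-wiring if each vertex of $Y$ has at most $k$ preimages among vertices of $\Gamma$ and each edge of $Y$ lies in at most $k$ of the paths $P_e$. Its volume is the number of vertices in its image. $\mathrm{wir}^k(\Gamma\to Y)$ is the minimal volume of a coarse $k$-wiring of $\Gamma$ into $Y$ ($+\infty$ if none), and $\mathrm{wir}^k_{X\to Y}(N)=\max\{\mathrm{wir}^k(\Gamma\to Y):\Gamma\text{ a subgraph of }X \text{ with at most } N \text{ vertices}\}$. -}

module Defs where

open import Data.Nat using (ℕ; zero; suc; _+_; _*_; _^_; _≤_; _<_; _≡ᵇ_; _<ᵇ_)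
open import Data.Nat.Divisibility using (_∣_)
open import Data.Nat.ListAction using (sum)
open import Data.Bool using (Bool; true; false; _∧_; _∨_; if_then_else_)
open import Data.Fin using (Fin; toℕ)
open import Data.List using (List; []; _∷_; [_]; map; length; allFin)
open import Data.List.Membership.Propositional using (_∈_)
open import Data.Product using (Σ; ∃; _×_; _,_)
open import Data.Sum using (_⊎_)
open import Relation.Binary.PropositionalEquality using (_≡_)

-- Vertices of the disjoint unions X = ⊔ X_n and Y = ⊔ Y_n are encoded
-- as triples (n , i , j) : ℕ × ℕ × ℕ  (component n, coordinates (i,j)).

Vert : Set
Vert = ℕ × ℕ × ℕ

_==V_ : Vert → Vert → Bool
(n , i , j) ==V (n' , i' , j') = (n ≡ᵇ n') ∧ ((i ≡ᵇ i') ∧ (j ≡ᵇ j'))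

LX : ℕ → ℕ
LX n = 2 ^ (2 ^ (2 * n))

LY : ℕ → ℕ
LY n = 2 ^ (2 ^ (2 * n + 1))

IsVert : (ℕ → ℕ) → (ℕ → ℕ) → Vert → Set
IsVert f L (n , i , j) = (1 ≤ n) × (i < f n) × (j ≤ L n * f n)

Step : (ℕ → ℕ) → (ℕ → ℕ) → Vert → Vert → Set
Step f L (n , i , j) (n' , i' , j') =
  IsVert f L (n , i , j) × IsVert f L (n' , i' , j') × (n ≡ n') ×
  ( ((i ≡ i') × (j' ≡ suc j))
  ⊎ ((j ≡ j') × (i' ≡ suc i) × (L n ∣ j)) )

Adj : (ℕ → ℕ) → (ℕ → ℕ) → Vert → Vert → Set
Adj f L u v = Step f L u v ⊎ Step f L v u

XVert YVert : (ℕ → ℕ) → Vert → Set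
XVert f = IsVert f LX
YVert f = IsVert f LY

XAdj YAdj : (ℕ → ℕ) → Vert → Vert → Set
XAdj f = Adj f LX
YAdj f = Adj f LY

-- A finite subgraph Γ of X with m vertices: an injective labelling
-- ι : Fin m → vertices of X, and an edge indicator E; the edges of Γ are
-- the pairs {a , b} with toℕ a < toℕ b and E a b ≡ true, each of which
-- must be an edge of X.

IsEdge : {m : ℕ} → (Fin m → Fin m → Bool) → Fin m → Fin m → Bool
IsEdge E a b = (toℕ a <ᵇ toℕ b) ∧ E a b

record Subgraph (f : ℕ → ℕ) (m : ℕ) : Set where
  field
    ι     : Fin m → Vert
    E     : Fin m → Fin m → Bool
    ι-inj : ∀ a b → ι a ≡ ι b → a ≡ b
    ι-X   : ∀ a → XVert f (ι a)
    E-X   : ∀ a b → IsEdge E a b ≡ true → XAdj f (ι a) (ι b)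

data YPath (f : ℕ → ℕ) : Vert → Vert → List Vert → Set where
  single : ∀ {y} → YVert f y → YPath f y y [ y ]
  step   : ∀ {x y z ps} → YAdj f x y → YPath f y z ps → YPath f x z (x ∷ ps)

uses : List Vert → Vert → Vert → Bool
uses (x ∷ y ∷ r) u v = ((x ==V u) ∧ (y ==V v)) ∨ ((x ==V v) ∧ (y ==V u)) ∨ uses (y ∷ r) u v
uses _ u v = false

countᵇ : {A : Set} → (A → Bool) → List A → ℕ
countᵇ p xs = sum (map (λ x → if p x then 1 else 0) xs)

record CoarseWiring (f : ℕ → ℕ) {m : ℕ} (Γ : Subgraph f m) (k V : ℕ) : Set where
  open Subgraph Γ
  field
    g      : Fin m → Vert
    P      : Fin m → Fin m → List Vert
    g-Y    : ∀ a → YVert f (g a)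
    P-path : ∀ a b → IsEdge E a b ≡ true → YPath f (g a) (g b) (P a b)
    vertex-coarse : ∀ y → YVert f y →
      countᵇ (λ a → g a ==V y) (allFin m) ≤ k
    edge-coarse : ∀ y y' → YAdj f y y' →
      sum (map (λ a → countᵇ (λ b → IsEdge E a b ∧ uses (P a b) y y') (allFin m))
               (allFin m)) ≤ k
    -- volume ≤ V: the image (images of vertices and all vertices of the
    -- paths P_e) is contained in a list of at most V vertices
    image  : List Vert
    image-length : length image ≤ V
    g-image : ∀ a → g a ∈ image
    P-image : ∀ a b → IsEdge E a b ≡ true → ∀ v → v ∈ P a b → v ∈ image

-- Hypotheses on f (ℕ of the paper = positive naturals; f 0 is ignored).
record Admissible (f : ℕ → ℕ) : Set where
  field
    surj     : ∀ m → 1 ≤ m → ∃ λ n → (1 ≤ n) × (f n ≡ m)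
    f1       : f 1 ≡ 1
    bounds   : ∀ n → 2 ≤ n → (2 ≤ f n) × (f n ≤ n)
    infinite : ∀ m → 2 ≤ m → ∀ B → ∃ λ n → (B ≤ n) × (f n ≡ m)

sizeX : (ℕ → ℕ) → ℕ → ℕ
sizeX f n = (LX n * f n + 1) * f n

-- Wire each component X_k into Y_k.  For k ≠ n the wiring is (i , j) ↦ (i , ψ k j), where ψ k
-- stretches heights so that the rungs of X_k (heights in LX k ℕ) land on rungs of Y_k: once per
-- period LX k a jump of LY k ∸ LX k is inserted, at a fixed residue.  This is injective and sends
-- vertical edges to vertical runs and rungs to rungs.  X_n is instead folded onto column 0 of Y_n,
-- its f n columns becoming layers; this costs multiplicity f n at vertices and edges and nothing
-- more, because an edge of Y determines the edge of X whose path runs through it once the layer is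
-- known.  For the volume, the components below n are counted whole (Y_1 … Y_{n-1} are tiny
-- compared with LX n = LY (n - 1)²), component n contributes its folded column, and above n the
-- jump residue is chosen among 1 … m + 1 so as to avoid every vertex of Γ: there each vertical edge
-- of Γ becomes a single edge of Y and nothing outside the wired vertices of Γ is used.
module Submission where

open import Defs
open import Data.Bool using (Bool; true; false; _∧_; _∨_; not; T)
open import Data.Bool.Properties using (∧-conicalˡ; ∧-conicalʳ)
open import Data.Nat using (ℕ; zero; suc; pred; _+_; _*_; _^_; _∸_; _≤_; _<_; z≤n; s≤s; z<s; _≟_; _≤?_; _<?_; _≡ᵇ_; _<ᵇ_; NonZero; >-nonZero; >-nonZero⁻¹)
open import Data.Nat.Divisibility using (_∣_; divides)
open import Data.Nat.DivMod using (_%_; n%n≡0; [m+n]%n≡m%n; m<n⇒m%n≡m)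
open import Data.Nat.Properties
open import Data.Nat.Tactic.RingSolver using (solve-∀)
open import Algebra.Properties.CommutativeSemigroup +-commutativeSemigroup using (xy∙z≈xz∙y)
open import Data.Nat.ListAction using (sum)
open import Data.Nat.ListAction.Properties using (sum-++)
open import Data.List using (List; []; _∷_; [_]; _++_; map; length; cartesianProduct; allFin; upTo)
open import Data.List.Membership.Propositional using (_∈_)
open import Data.List.Relation.Unary.Any using (here; there)
open import Data.List.Membership.Propositional.Properties using (∈-++⁺ˡ; ∈-++⁺ʳ; ∈-map⁺; ∈-allFin; ∈-upTo⁺; ∈-cartesianProduct⁺)
open import Data.List.Properties using (map-++; map-∘; length-++; length-map; length-upTo; length-tabulate)
open import Data.List.Relation.Unary.All as All using (All; []; _∷_)
open import Data.List.Relation.Unary.Unique.Propositional using (Unique; []; _∷_)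
open import Data.List.Relation.Unary.Unique.Propositional.Properties using (allFin⁺; cartesianProduct⁺)
open import Data.Product using (_×_; _,_; uncurry; proj₁; proj₂; ∃-syntax)
open import Data.Fin using (Fin; toℕ)
open import Data.Fin.Properties using (any?; ¬∀⟶∃¬; pigeonhole; toℕ<n)
open import Data.Sum using (_⊎_; inj₁; inj₂; [_,_]′)
open import Relation.Binary.Definitions using (Tri; tri<; tri≈; tri>)
open import Data.Empty using (⊥; ⊥-elim)
open import Relation.Nullary using (Dec; yes; no; ¬_)
open import Relation.Nullary.Decidable using (⌊_⌋)
open import Relation.Binary.PropositionalEquality hiding ([_])
open import Function using (_∘_; id)

private variable
  A B : Set

-- Counting

∧-false : ∀ b → b ∧ false ≢ true
∧-false true ()
∧-false false ()

countᵇ-map : ∀ (p : B → Bool) (g : A → B) xs → countᵇ p (map g xs) ≡ countᵇ (p ∘ g) xs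
countᵇ-map p g xs = cong sum (sym (map-∘ xs))

countᵇ-++ : ∀ (p : A → Bool) xs ys → countᵇ p (xs ++ ys) ≡ countᵇ p xs + countᵇ p ys
countᵇ-++ p xs ys = trans (cong sum (map-++ _ xs ys)) (sum-++ (map _ xs) _)

countᵇ-none : ∀ (p : A → Bool) {xs} → All (λ x → p x ≡ false) xs → countᵇ p xs ≡ 0
countᵇ-none p [] = refl
countᵇ-none p (px ∷ pxs) rewrite px = countᵇ-none p pxs

countᵇ-split : ∀ (p q : A → Bool) xs →
  countᵇ p xs ≡ countᵇ (λ x → p x ∧ q x) xs + countᵇ (λ x → p x ∧ not (q x)) xs
countᵇ-split p q [] = refl
countᵇ-split p q (x ∷ xs) with p x | q x
... | false | _     = countᵇ-split p q xs
... | true  | true  = cong suc (countᵇ-split p q xs)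
... | true  | false = trans (cong suc (countᵇ-split p q xs)) (sym (+-suc _ _))

countᵇ-≤1 : ∀ (p : A → Bool) {xs} → Unique xs →
  (∀ x y → p x ≡ true → p y ≡ true → x ≡ y) → countᵇ p xs ≤ 1
countᵇ-≤1 p [] _ = z≤n
countᵇ-≤1 p {x ∷ xs} (x∉xs ∷ u) unique with p x in px
... | false = countᵇ-≤1 p u unique
... | true  = ≤-reflexive (cong suc (countᵇ-none p (All.map rest-false x∉xs)))
  where
  rest-false : ∀ {y} → x ≢ y → p y ≡ false
  rest-false {y} x≢y with p y in py
  ... | false = refl
  ... | true  = ⊥-elim (x≢y (unique x y px py))

countᵇ-≤-injection : ∀ {A : Set} (p : A → Bool) (h : A → ℕ) K {xs} → Unique xs →
  (∀ x → p x ≡ true → h x < K) →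
  (∀ x y → p x ≡ true → p y ≡ true → h x ≡ h y → x ≡ y) →
  countᵇ p xs ≤ K
countᵇ-≤-injection p h zero {xs} _ bound _ =
  ≤-reflexive (countᵇ-none p {xs} (All.tabulate λ {x} _ → nowhere x))
  where
  nowhere : ∀ x → p x ≡ false
  nowhere x with p x in px
  ... | false = refl
  ... | true  with () ← bound x px
countᵇ-≤-injection {A} p h (suc K) {xs} u bound inj = begin
  countᵇ p xs                              ≡⟨ countᵇ-split p onTop xs ⟩
  countᵇ (λ x → p x ∧ onTop x) xs + countᵇ (λ x → p x ∧ not (onTop x)) xs
    ≤⟨ +-mono-≤ (countᵇ-≤1 _ u top-unique) (countᵇ-≤-injection _ h K u below inj-below) ⟩
  suc K                                    ∎
  where
  open ≤-Reasoning
  onTop : A → Bool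
  onTop x = ⌊ h x ≟ K ⌋
  top-unique : ∀ x y → p x ∧ onTop x ≡ true → p y ∧ onTop y ≡ true → x ≡ y
  top-unique x y qx qy with h x ≟ K | h y ≟ K
  ... | yes hx | yes hy = inj x y (∧-conicalˡ _ _ qx) (∧-conicalˡ _ _ qy) (trans hx (sym hy))
  ... | no _   | _      = ⊥-elim (∧-false (p x) qx)
  ... | yes _  | no _   = ⊥-elim (∧-false (p y) qy)
  below : ∀ x → p x ∧ not (onTop x) ≡ true → h x < K
  below x qx with h x ≟ K
  ... | no hx≢K = ≤∧≢⇒< (≤-pred (bound x (∧-conicalˡ _ _ qx))) hx≢K
  ... | yes _   = ⊥-elim (∧-false (p x) qx)
  inj-below : ∀ x y → p x ∧ not (onTop x) ≡ true → p y ∧ not (onTop y) ≡ true → h x ≡ h y → x ≡ y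
  inj-below x y qx qy = inj x y (∧-conicalˡ _ _ qx) (∧-conicalˡ _ _ qy)

sum-countᵇ≡countᵇ-cartesianProduct : ∀ (q : A → B → Bool) xs ys →
  sum (map (λ x → countᵇ (q x) ys) xs) ≡ countᵇ (uncurry q) (cartesianProduct xs ys)
sum-countᵇ≡countᵇ-cartesianProduct q [] ys = refl
sum-countᵇ≡countᵇ-cartesianProduct q (x ∷ xs) ys = begin
  countᵇ (q x) ys + sum (map (λ x → countᵇ (q x) ys) xs)
    ≡⟨ cong₂ _+_ (sym (countᵇ-map (uncurry q) (x ,_) ys)) (sum-countᵇ≡countᵇ-cartesianProduct q xs ys) ⟩
  countᵇ (uncurry q) (map (x ,_) ys) + countᵇ (uncurry q) (cartesianProduct xs ys)
    ≡⟨ sym (countᵇ-++ (uncurry q) (map (x ,_) ys) _) ⟩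
  countᵇ (uncurry q) (cartesianProduct (x ∷ xs) ys) ∎
  where open ≡-Reasoning

length-cartesianProduct : ∀ (xs : List A) (ys : List B) → length (cartesianProduct xs ys) ≡ length xs * length ys
length-cartesianProduct []       ys = refl
length-cartesianProduct (x ∷ xs) ys = begin
  length (map (x ,_) ys ++ cartesianProduct xs ys)       ≡⟨ length-++ (map (x ,_) ys) ⟩
  length (map (x ,_) ys) + length (cartesianProduct xs ys)
    ≡⟨ cong₂ _+_ (length-map (x ,_) ys) (length-cartesianProduct xs ys) ⟩
  length ys + length xs * length ys                       ∎
  where open ≡-Reasoning

missing-value : ∀ {m} (h : Fin m → ℕ) → ∃[ r ] r ≤ m × (∀ a → h a ≢ r)
missing-value {m} h with ¬∀⟶∃¬ (suc m) (λ x → ∃[ a ] h a ≡ toℕ x) (λ x → any? (λ a → h a ≟ toℕ x)) all-hit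
  where
  all-hit : ¬ (∀ x → ∃[ a ] h a ≡ toℕ x)
  all-hit hit with pigeonhole (n<1+n m) (proj₁ ∘ hit)
  ... | i , j , i<j , same = <⇒≢ i<j (trans (sym (proj₂ (hit i))) (trans (cong h same) (proj₂ (hit j))))
... | x , missed = toℕ x , ≤-pred (toℕ<n x) , λ a ha≡ → missed (a , ha≡)

-- Stretching heights

-- stretch j = j + D · #{t ∈ 1 … j | t % L ≡ suc r}: each step up to a height of residue suc r is
-- lengthened by D.
module Stretch (L : ℕ) {{_ : NonZero L}} (D r : ℕ) where

  jump : ℕ → ℕ
  jump x with x ≟ suc r
  ... | yes _ = D
  ... | no _  = 0

  stretch : ℕ → ℕ
  stretch zero    = zero
  stretch (suc j) = suc (stretch j) + jump (suc j % L)

  jump-other : ∀ x → x ≢ suc r → jump x ≡ 0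
  jump-other x x≢ with x ≟ suc r
  ... | yes x≡ = ⊥-elim (x≢ x≡)
  ... | no _   = refl

  jump-self : jump (suc r) ≡ D
  jump-self with suc r ≟ suc r
  ... | yes _ = refl
  ... | no r≢r = ⊥-elim (r≢r refl)

  stretch-short : ∀ j → suc j % L ≢ suc r → stretch (suc j) ≡ suc (stretch j)
  stretch-short j j≢ = trans (cong (suc (stretch j) +_) (jump-other (suc j % L) j≢)) (+-identityʳ _)

  stretch-<-suc : ∀ j → stretch j < stretch (suc j)
  stretch-<-suc j = m≤m+n (suc (stretch j)) _

  stretch-mono-≤ : ∀ {j j'} → j ≤ j' → stretch j ≤ stretch j'
  stretch-mono-≤ {j' = zero}   z≤n  = ≤-refl
  stretch-mono-≤ {j' = suc j'} j≤ with m≤n⇒m<n∨m≡n j≤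
  ... | inj₁ j<   = ≤-trans (stretch-mono-≤ (≤-pred j<)) (<⇒≤ (stretch-<-suc j'))
  ... | inj₂ refl = ≤-refl

  stretch-interval-unique : ∀ {j j' t} → stretch j ≤ t → t < stretch (suc j) →
    stretch j' ≤ t → t < stretch (suc j') → j ≡ j'
  stretch-interval-unique {j} {j'} lo hi lo' hi' with <-cmp j j'
  ... | tri< j<j' _ _ = ⊥-elim (<-irrefl refl (<-≤-trans hi (≤-trans (stretch-mono-≤ j<j') lo')))
  ... | tri≈ _ j≡j' _ = j≡j'
  ... | tri> _ _ j'<j = ⊥-elim (<-irrefl refl (<-≤-trans hi' (≤-trans (stretch-mono-≤ j'<j) lo)))

  stretch-injective : ∀ {j j'} → stretch j ≡ stretch j' → j ≡ j'
  stretch-injective {j} {j'} eq = stretch-interval-unique ≤-refl (stretch-<-suc j)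
    (≤-reflexive (sym eq)) (subst (_< stretch (suc j')) (sym eq) (stretch-<-suc j'))

  stretch-flat : ∀ s d → (∀ t → s < t → t ≤ s + d → t % L ≢ suc r) → stretch (s + d) ≡ stretch s + d
  stretch-flat s zero    _    = trans (cong stretch (+-identityʳ s)) (sym (+-identityʳ _))
  stretch-flat s (suc d) flat = begin
    stretch (s + suc d)    ≡⟨ cong stretch (+-suc s d) ⟩
    stretch (suc (s + d))  ≡⟨ stretch-short (s + d) (flat _ (s≤s (m≤m+n s d)) (≤-reflexive (sym (+-suc s d)))) ⟩
    suc (stretch (s + d))  ≡⟨ cong suc (stretch-flat s d λ t s<t t≤ → flat t s<t (≤-trans t≤ (+-monoʳ-≤ s (n≤1+n d)))) ⟩
    suc (stretch s + d)    ≡⟨ sym (+-suc _ d) ⟩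
    stretch s + suc d      ∎
    where open ≡-Reasoning

  stretch-period : suc r < L → stretch L ≡ L + D
  stretch-period r<L = begin
    stretch L                      ≡⟨ cong stretch (sym (m+[n∸m]≡n (<⇒≤ r<L))) ⟩
    stretch (suc r + (L ∸ suc r))  ≡⟨ stretch-flat (suc r) (L ∸ suc r) after-jump ⟩
    stretch (suc r) + (L ∸ suc r)  ≡⟨ cong (_+ (L ∸ suc r)) at-jump ⟩
    suc r + D + (L ∸ suc r)        ≡⟨ xy∙z≈xz∙y (suc r) D _ ⟩
    suc r + (L ∸ suc r) + D        ≡⟨ cong (_+ D) (m+[n∸m]≡n (<⇒≤ r<L)) ⟩
    L + D                          ∎
    where
    open ≡-Reasoning
    before-jump : stretch r ≡ r
    before-jump = stretch-flat 0 r λ t _ t≤r t%L≡ →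
      <⇒≢ (s≤s t≤r) (trans (sym (m<n⇒m%n≡m (<-trans (s≤s t≤r) r<L))) t%L≡)
    at-jump : stretch (suc r) ≡ suc r + D
    at-jump rewrite m<n⇒m%n≡m r<L | jump-self | before-jump = refl
    after-jump : ∀ t → suc r < t → t ≤ suc r + (L ∸ suc r) → t % L ≢ suc r
    after-jump t r<t t≤ with m≤n⇒m<n∨m≡n (subst (t ≤_) (m+[n∸m]≡n (<⇒≤ r<L)) t≤)
    ... | inj₁ t<L = subst (_≢ suc r) (sym (m<n⇒m%n≡m t<L)) (>⇒≢ r<t)
    ... | inj₂ refl = subst (_≢ suc r) (sym (n%n≡0 L)) λ ()

  stretch-periodic : suc r < L → ∀ j → stretch (j + L) ≡ stretch j + (L + D)
  stretch-periodic r<L zero    = stretch-period r<L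
  stretch-periodic r<L (suc j) = begin
    suc (stretch (j + L)) + jump ((suc j + L) % L)
      ≡⟨ cong₂ (λ s x → suc s + jump x) (stretch-periodic r<L j) ([m+n]%n≡m%n (suc j) L) ⟩
    suc (stretch j) + (L + D) + jump (suc j % L)
      ≡⟨ xy∙z≈xz∙y (suc (stretch j)) (L + D) _ ⟩
    suc (stretch j) + jump (suc j % L) + (L + D) ∎
    where open ≡-Reasoning

  stretch-multiple : suc r < L → ∀ q → stretch (q * L) ≡ q * (L + D)
  stretch-multiple r<L zero    = refl
  stretch-multiple r<L (suc q) = begin
    stretch (L + q * L)          ≡⟨ cong stretch (+-comm L (q * L)) ⟩
    stretch (q * L + L)          ≡⟨ stretch-periodic r<L (q * L) ⟩
    stretch (q * L) + (L + D)    ≡⟨ cong (_+ (L + D)) (stretch-multiple r<L q) ⟩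
    q * (L + D) + (L + D)        ≡⟨ +-comm _ (L + D) ⟩
    suc q * (L + D)              ∎
    where open ≡-Reasoning

-- The scales LX and LY

LX-nonZero : ∀ k → NonZero (LX k)
LX-nonZero k = m^n≢0 2 (2 ^ (2 * k))

n<2^n : ∀ x → x < 2 ^ x
n<2^n zero    = z<s
n<2^n (suc x) = begin-strict
  suc x            <⟨ s≤s (n<2^n x) ⟩
  suc (2 ^ x)      ≤⟨ +-monoˡ-≤ (2 ^ x) (m^n>0 2 x) ⟩
  2 ^ x + 2 ^ x    ≡⟨ cong (2 ^ x +_) (sym (+-identityʳ (2 ^ x))) ⟩
  2 ^ suc x        ∎
  where open ≤-Reasoning

x+x≡x*2 : ∀ x → x + x ≡ x * 2
x+x≡x*2 = solve-∀

2^[2*a]≡2^a*2^a : ∀ a → 2 ^ (2 * a) ≡ 2 ^ a * 2 ^ a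
2^[2*a]≡2^a*2^a a = trans (cong (2 ^_) (cong (a +_) (+-identityʳ a))) (^-distribˡ-+-* 2 a a)

LY≡LX*LX : ∀ k → LY k ≡ LX k * LX k
LY≡LX*LX k = trans (cong (λ e → 2 ^ (2 ^ e)) (+-comm (2 * k) 1)) (2^[2*a]≡2^a*2^a (2 ^ (2 * k)))

LX-suc≡LY*LY : ∀ k → LX (suc k) ≡ LY k * LY k
LX-suc≡LY*LY k = trans (cong (λ e → 2 ^ (2 ^ e)) (exponent k)) (2^[2*a]≡2^a*2^a (2 ^ (2 * k + 1)))
  where
  exponent : ∀ k → 2 * suc k ≡ suc (2 * k + 1)
  exponent = solve-∀

LX-mono-≤ : ∀ {k k'} → k ≤ k' → LX k ≤ LX k'
LX-mono-≤ k≤k' = ^-monoʳ-≤ 2 (^-monoʳ-≤ 2 (*-monoʳ-≤ 2 k≤k'))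

LY-mono-≤ : ∀ {k k'} → k ≤ k' → LY k ≤ LY k'
LY-mono-≤ k≤k' = ^-monoʳ-≤ 2 (^-monoʳ-≤ 2 (+-monoˡ-≤ 1 (*-monoʳ-≤ 2 k≤k')))

LX≤LY : ∀ k → LX k ≤ LY k
LX≤LY k = ^-monoʳ-≤ 2 (^-monoʳ-≤ 2 (m≤m+n (2 * k) 1))

2≤LX : ∀ k → 2 ≤ LX k
2≤LX k = ^-monoʳ-≤ 2 (m^n>0 2 (2 * k))

n<LX : ∀ n → n < LX n
n<LX n = begin-strict
  n                <⟨ n<2^n n ⟩
  2 ^ n            ≤⟨ ^-monoʳ-≤ 2 (m≤m+n n (n + 0)) ⟩
  2 ^ (2 * n)      <⟨ n<2^n (2 ^ (2 * n)) ⟩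
  LX n             ∎
  where open ≤-Reasoning

cube≤LY : ∀ p → suc p * (suc p * suc p) ≤ LY p
cube≤LY p = begin
  suc p * (suc p * suc p)    ≤⟨ *-mono-≤ p<2^p (*-mono-≤ p<2^p p<2^p) ⟩
  2 ^ p * (2 ^ p * 2 ^ p)    ≡⟨ sym (trans (^-distribˡ-+-* 2 p (p + p)) (cong (2 ^ p *_) (^-distribˡ-+-* 2 p p))) ⟩
  2 ^ (p + (p + p))          ≤⟨ ^-monoʳ-≤ 2 exponent ⟩
  LY p                       ∎
  where
  open ≤-Reasoning
  p<2^p : suc p ≤ 2 ^ p
  p<2^p = n<2^n p
  four-p+2 : ∀ p → p + (p + p) + (p + 2) ≡ 2 * suc (2 * p)
  four-p+2 = solve-∀
  exponent : p + (p + p) ≤ 2 ^ (2 * p + 1)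
  exponent = begin
    p + (p + p)                ≤⟨ m≤m+n _ (p + 2) ⟩
    p + (p + p) + (p + 2)      ≡⟨ four-p+2 p ⟩
    2 * suc (2 * p)            ≤⟨ *-monoʳ-≤ 2 (n<2^n (2 * p)) ⟩
    2 ^ suc (2 * p)            ≡⟨ cong (2 ^_) (+-comm 1 (2 * p)) ⟩
    2 ^ (2 * p + 1)            ∎

lower-volume≤ : ∀ n F → 1 ≤ n → 2 ≤ F → n * (n * suc (LY (pred n) * n)) ≤ LX n * F
lower-volume≤ (suc p) F _ 2≤F = begin
  n * (n * suc (M * n))      ≡⟨ expand n M ⟩
  n * (n * n) * M + n * n    ≤⟨ +-mono-≤ (*-monoˡ-≤ M (cube≤LY p)) n*n≤M ⟩
  M * M + M                  ≤⟨ +-monoʳ-≤ (M * M) (m≤m*n M M {{>-nonZero (≤-trans (s≤s z≤n) n*n≤M)}}) ⟩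
  M * M + M * M              ≡⟨ x+x≡x*2 (M * M) ⟩
  M * M * 2                  ≤⟨ *-monoʳ-≤ (M * M) 2≤F ⟩
  M * M * F                  ≡⟨ cong (_* F) (sym (LX-suc≡LY*LY p)) ⟩
  LX (suc p) * F             ∎
  where
  open ≤-Reasoning
  n M : ℕ
  n = suc p
  M = LY p
  expand : ∀ n M → n * (n * suc (M * n)) ≡ n * (n * n) * M + n * n
  expand = solve-∀
  n*n≤M : n * n ≤ M
  n*n≤M = ≤-trans (*-monoʳ-≤ n (m≤m*n n n)) (cube≤LY p)

volume-≤ : ∀ B A F m → B ≤ A → m ≤ A * F → 2 ≤ F → B + (A + m) ≤ 2 * (A * F)
volume-≤ B A F m B≤A m≤ 2≤F = begin
  B + (A + m)        ≤⟨ +-monoˡ-≤ (A + m) B≤A ⟩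
  A + (A + m)        ≡⟨ sym (+-assoc A A m) ⟩
  A + A + m          ≤⟨ +-mono-≤ (≤-trans (≤-reflexive (x+x≡x*2 A)) (*-monoʳ-≤ A 2≤F)) m≤ ⟩
  A * F + A * F      ≡⟨ cong (A * F +_) (sym (+-identityʳ (A * F))) ⟩
  2 * (A * F)        ∎
  where
  open ≤-Reasoning

room-for-residue : ∀ f n m → f n ≤ n → m ≤ sizeX f n → suc m < LX (suc n)
room-for-residue f n m fn≤n m≤ = begin-strict
  suc m                       ≤⟨ s≤s m≤ ⟩
  suc ((X * F + 1) * F)       ≤⟨ s≤s (*-monoˡ-≤ F XF+1≤X*X) ⟩
  suc (X * X * F)             ≡⟨ +-comm 1 (X * X * F) ⟩
  X * X * F + 1               ≤⟨ +-monoʳ-≤ (X * X * F) (>-nonZero⁻¹ (X * X) {{X*X≢0}}) ⟩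
  X * X * F + X * X           ≡⟨ cong (X * X * F +_) (sym (*-identityʳ (X * X))) ⟩
  X * X * F + X * X * 1       ≡⟨ sym (*-distribˡ-+ (X * X) F 1) ⟩
  X * X * (F + 1)             ≤⟨ *-monoʳ-≤ (X * X) (≤-trans (≤-reflexive (+-comm F 1)) F<X) ⟩
  X * X * X                   <⟨ *-monoʳ-< (X * X) {{X*X≢0}} (m<m*n X X {{X≢0}} (2≤LX n)) ⟩
  X * X * (X * X)             ≡⟨ cong₂ _*_ (sym (LY≡LX*LX n)) (sym (LY≡LX*LX n)) ⟩
  LY n * LY n                 ≡⟨ sym (LX-suc≡LY*LY n) ⟩
  LX (suc n)                  ∎
  where
  open ≤-Reasoning
  X F : ℕ
  X = LX n
  F = f n
  X≢0 : NonZero X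
  X≢0 = LX-nonZero n
  X*X≢0 : NonZero (X * X)
  X*X≢0 = m*n≢0 X X {{X≢0}} {{X≢0}}
  F<X : F < X
  F<X = ≤-<-trans fn≤n (n<LX n)
  XF+1≤X*X : X * F + 1 ≤ X * X
  XF+1≤X*X = begin
    X * F + 1        ≤⟨ +-monoʳ-≤ (X * F) (>-nonZero⁻¹ X {{X≢0}}) ⟩
    X * F + X        ≡⟨ +-comm (X * F) X ⟩
    X + X * F        ≡⟨ sym (*-suc X F) ⟩
    X * suc F        ≤⟨ *-monoʳ-≤ X F<X ⟩
    X * X            ∎

-- Paths in Y

∨-split : ∀ a b → a ∨ b ≡ true → a ≡ true ⊎ b ≡ true
∨-split true  _ _ = inj₁ refl
∨-split false _ e = inj₂ e

≡ᵇ-sound : ∀ x y → (x ≡ᵇ y) ≡ true → x ≡ y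
≡ᵇ-sound x y e = ≡ᵇ⇒≡ x y (subst T (sym e) _)

==V-sound : ∀ x y → (x ==V y) ≡ true → x ≡ y
==V-sound (k , i , j) (k' , i' , j') e
  with ∧-conicalˡ (k ≡ᵇ k') _ e | ∧-conicalʳ (k ≡ᵇ k') _ e
... | k≡ | ij≡ rewrite ≡ᵇ-sound k k' k≡
                     | ≡ᵇ-sound i i' (∧-conicalˡ (i ≡ᵇ i') (j ≡ᵇ j') ij≡)
                     | ≡ᵇ-sound j j' (∧-conicalʳ (i ≡ᵇ i') (j ≡ᵇ j') ij≡) = refl

triple-injective : ∀ {k i j k' i' j' : ℕ} → (k , i , j) ≡ (k' , i' , j') → k ≡ k' × i ≡ i' × j ≡ j'
triple-injective refl = refl , refl , refl

SamePair : Vert → Vert → Vert → Vert → Set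
SamePair x x' y y' = (x ≡ y × x' ≡ y') ⊎ (x ≡ y' × x' ≡ y)

SamePair-match : ∀ {x x' y y' z z'} → SamePair x x' y y' → SamePair z z' y y' → SamePair x x' z z'
SamePair-match (inj₁ (x≡ , x'≡)) (inj₁ (z≡ , z'≡)) = inj₁ (trans x≡ (sym z≡) , trans x'≡ (sym z'≡))
SamePair-match (inj₁ (x≡ , x'≡)) (inj₂ (z≡ , z'≡)) = inj₂ (trans x≡ (sym z'≡) , trans x'≡ (sym z≡))
SamePair-match (inj₂ (x≡ , x'≡)) (inj₁ (z≡ , z'≡)) = inj₂ (trans x≡ (sym z'≡) , trans x'≡ (sym z≡))
SamePair-match (inj₂ (x≡ , x'≡)) (inj₂ (z≡ , z'≡)) = inj₁ (trans x≡ (sym z≡) , trans x'≡ (sym z'≡))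

private
  no-2-cycle : ∀ {t t'} → t ≡ suc t' → suc t ≡ t' → ⊥
  no-2-cycle refl ()

vertical-edges-agree : ∀ {k c t k' c' t'} →
  SamePair (k , c , t) (k , c , suc t) (k' , c' , t') (k' , c' , suc t') → (k , c , t) ≡ (k' , c' , t')
vertical-edges-agree (inj₁ (same , _)) = same
vertical-edges-agree (inj₂ (e , e')) = ⊥-elim (no-2-cycle (proj₂ (proj₂ (triple-injective e))) (proj₂ (proj₂ (triple-injective e'))))

horizontal-edges-agree : ∀ {k i s k' i' s'} →
  SamePair (k , i , s) (k , suc i , s) (k' , i' , s') (k' , suc i' , s') → (k , i , s) ≡ (k' , i' , s')
horizontal-edges-agree (inj₁ (same , _)) = same
horizontal-edges-agree (inj₂ (e , e')) = ⊥-elim (no-2-cycle (proj₁ (proj₂ (triple-injective e))) (proj₁ (proj₂ (triple-injective e'))))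

vertical≢horizontal : ∀ {k c t k' i s} → ¬ SamePair (k , c , t) (k , c , suc t) (k' , i , s) (k' , suc i , s)
vertical≢horizontal (inj₁ (e , e')) = 1+n≢n (trans (sym (proj₁ (proj₂ (triple-injective e')))) (proj₁ (proj₂ (triple-injective e))))
vertical≢horizontal (inj₂ (e , e')) = 1+n≢n (trans (sym (proj₁ (proj₂ (triple-injective e)))) (proj₁ (proj₂ (triple-injective e'))))

SamePair-sym : ∀ {x x' y y'} → SamePair x x' y y' → SamePair y y' x x'
SamePair-sym (inj₁ (p , q)) = inj₁ (sym p , sym q)
SamePair-sym (inj₂ (p , q)) = inj₂ (sym q , sym p)

SamePair-swap : ∀ {x x' y y'} → SamePair x x' y y' → SamePair x' x y y'
SamePair-swap (inj₁ (p , q)) = inj₂ (q , p)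
SamePair-swap (inj₂ (p , q)) = inj₁ (q , p)

uses-∷ : ∀ x x' ps y y' → uses (x ∷ x' ∷ ps) y y' ≡ true → SamePair x x' y y' ⊎ uses (x' ∷ ps) y y' ≡ true
uses-∷ x x' ps y y' e with ∨-split _ _ e
... | inj₁ e₁ = inj₁ (inj₁ (==V-sound x y (∧-conicalˡ (x ==V y) _ e₁) , ==V-sound x' y' (∧-conicalʳ (x ==V y) _ e₁)))
... | inj₂ e₂ with ∨-split _ _ e₂
... | inj₁ e₃ = inj₁ (inj₂ (==V-sound x y' (∧-conicalˡ (x ==V y') _ e₃) , ==V-sound x' y (∧-conicalʳ (x ==V y') _ e₃)))
... | inj₂ e₄ = inj₂ e₄

uses-pair : ∀ x x' y y' → uses (x ∷ x' ∷ []) y y' ≡ true → SamePair x x' y y'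
uses-pair x x' y y' e with uses-∷ x x' [] y y' e
... | inj₁ same = same

columnUp : ℕ → ℕ → ℕ → ℕ → List Vert
columnUp k c s zero    = [ (k , c , s) ]
columnUp k c s (suc d) = (k , c , s) ∷ columnUp k c (suc s) d

columnDown : ℕ → ℕ → ℕ → ℕ → List Vert
columnDown k c s zero    = [ (k , c , s) ]
columnDown k c s (suc d) = (k , c , s + suc d) ∷ columnDown k c s d

InColumn : ℕ → ℕ → ℕ → ℕ → Vert → Set
InColumn k c s s' w = ∃[ t ] s ≤ t × t ≤ s' × w ≡ (k , c , t)

ColumnEdge : ℕ → ℕ → ℕ → ℕ → Vert → Vert → Set
ColumnEdge k c s s' y y' = ∃[ t ] s ≤ t × t < s' × SamePair (k , c , t) (k , c , suc t) y y'

columnUp-∈ : ∀ k c s d {w} → w ∈ columnUp k c s d → InColumn k c s (s + d) w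
columnUp-∈ k c s zero    (here refl) = s , ≤-refl , m≤m+n s 0 , refl
columnUp-∈ k c s (suc d) (here refl) = s , ≤-refl , m≤m+n s _ , refl
columnUp-∈ k c s (suc d) (there w∈) with columnUp-∈ k c (suc s) d w∈
... | t , s<t , t≤ , refl = t , <⇒≤ s<t , subst (t ≤_) (sym (+-suc s d)) t≤ , refl

columnDown-∈ : ∀ k c s d {w} → w ∈ columnDown k c s d → InColumn k c s (s + d) w
columnDown-∈ k c s zero    (here refl) = s , ≤-refl , m≤m+n s 0 , refl
columnDown-∈ k c s (suc d) (here refl) = s + suc d , m≤m+n s _ , ≤-refl , refl
columnDown-∈ k c s (suc d) (there w∈) with columnDown-∈ k c s d w∈
... | t , s≤t , t≤ , refl = t , s≤t , ≤-trans t≤ (+-monoʳ-≤ s (n≤1+n d)) , refl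

columnUp-uses : ∀ k c s d y y' → uses (columnUp k c s d) y y' ≡ true → ColumnEdge k c s (s + d) y y'
columnUp-uses k c s (suc zero) y y' e =
  s , ≤-refl , m<m+n s z<s , uses-pair _ _ y y' e
columnUp-uses k c s (suc (suc d)) y y' e =
  [ (λ same → s , ≤-refl , m<m+n s z<s , same)
  , (λ rest → lower (columnUp-uses k c (suc s) (suc d) y y' rest)) ]′
  (uses-∷ _ _ (columnUp k c (suc (suc s)) d) y y' e)
  where
  lower : ColumnEdge k c (suc s) (suc s + suc d) y y' → ColumnEdge k c s (s + suc (suc d)) y y'
  lower (t , s<t , t< , same) = t , <⇒≤ s<t , subst (t <_) (sym (+-suc s (suc d))) t< , same

columnDown-uses : ∀ k c s d y y' → uses (columnDown k c s d) y y' ≡ true → ColumnEdge k c s (s + d) y y'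
columnDown-uses k c s (suc zero) y y' e =
  s , ≤-refl , m<m+n s z<s , SamePair-swap (subst (λ x → SamePair x (k , c , s) y y') (cong (λ x → k , c , x) (+-comm s 1)) (uses-pair _ _ y y' e))
columnDown-uses k c s (suc (suc d)) y y' e =
  [ (λ same → s + suc d , m≤m+n s _ , +-monoʳ-< s ≤-refl ,
      SamePair-swap (subst (λ x → SamePair x (k , c , s + suc d) y y') (cong (λ x → k , c , x) (+-suc s (suc d))) same))
  , (λ rest → widen (columnDown-uses k c s (suc d) y y' rest)) ]′
  (uses-∷ _ _ (columnDown k c s d) y y' e)
  where
  widen : ColumnEdge k c s (s + suc d) y y' → ColumnEdge k c s (s + suc (suc d)) y y'
  widen (t , s≤t , t< , same) = t , s≤t , <-≤-trans t< (+-monoʳ-≤ s (n≤1+n _)) , same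

module _ (f : ℕ → ℕ) where

  columnUp-path : ∀ k c s d → (∀ t → s ≤ t → t ≤ s + d → YVert f (k , c , t)) →
    YPath f (k , c , s) (k , c , s + d) (columnUp k c s d)
  columnUp-path k c s zero    inY rewrite +-identityʳ s = single (inY s ≤-refl ≤-refl)
  columnUp-path k c s (suc d) inY rewrite +-suc s d =
    step (inj₁ (inY s ≤-refl (m≤n⇒m≤1+n (m≤m+n s d)) , inY (suc s) (n≤1+n s) (s≤s (m≤m+n s d)) , refl , inj₁ (refl , refl)))
         (columnUp-path k c (suc s) d λ t s<t t≤ → inY t (<⇒≤ s<t) t≤)

  columnDown-path : ∀ k c s d → (∀ t → s ≤ t → t ≤ s + d → YVert f (k , c , t)) →
    YPath f (k , c , s + d) (k , c , s) (columnDown k c s d)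
  columnDown-path k c s zero    inY rewrite +-identityʳ s = single (inY s ≤-refl ≤-refl)
  columnDown-path k c s (suc d) inY =
    step (inj₂ (inY (s + d) (m≤m+n s d) (+-monoʳ-≤ s (n≤1+n d)) , inY (s + suc d) (m≤m+n s _) ≤-refl , refl , inj₁ (refl , +-suc s d)))
         (columnDown-path k c s d λ t s≤t t≤ → inY t s≤t (≤-trans t≤ (+-monoʳ-≤ s (n≤1+n d))))

segment : Vert → Vert → List Vert
segment (k , c , s) (k' , c' , s') with c ≟ c' | s ≤? s'
... | no _  | _     = (k , c , s) ∷ (k' , c' , s') ∷ []
... | yes _ | yes _ = columnUp k c s (s' ∸ s)
... | yes _ | no _  = columnDown k c s' (s ∸ s')

segment-across : ∀ {k c s k' c' s'} → c ≢ c' → segment (k , c , s) (k' , c' , s') ≡ (k , c , s) ∷ (k' , c' , s') ∷ []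
segment-across {c = c} {s} {c' = c'} {s'} c≢c' with c ≟ c' | s ≤? s'
... | no _     | _     = refl
... | yes c≡c' | _     = ⊥-elim (c≢c' c≡c')

segment-up : ∀ {k c s s'} → s ≤ s' → segment (k , c , s) (k , c , s') ≡ columnUp k c s (s' ∸ s)
segment-up {c = c} {s} {s'} s≤s' with c ≟ c | s ≤? s'
... | no c≢c | _       = ⊥-elim (c≢c refl)
... | yes _  | yes _   = refl
... | yes _  | no s≰s' = ⊥-elim (s≰s' s≤s')

segment-down : ∀ {k c s s'} → s ≤ s' → segment (k , c , s') (k , c , s) ≡ columnDown k c s (s' ∸ s)
segment-down {c = c} {s} {s'} s≤s' with c ≟ c | s' ≤? s
... | no c≢c | _       = ⊥-elim (c≢c refl)
... | yes _  | no _    = refl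
... | yes _  | yes s'≤s rewrite ≤-antisym s≤s' s'≤s | n∸n≡0 s' = refl

module _ {k c s s' : ℕ} (s≤s' : s ≤ s') where

  private
    top : s + (s' ∸ s) ≡ s'
    top = m+[n∸m]≡n s≤s'

  column-segment-∈ : ∀ {w} → w ∈ segment (k , c , s) (k , c , s') ⊎ w ∈ segment (k , c , s') (k , c , s) →
    InColumn k c s s' w
  column-segment-∈ (inj₁ w∈) rewrite segment-up {k} {c} s≤s' = subst (λ x → InColumn k c s x _) top (columnUp-∈ k c s _ w∈)
  column-segment-∈ (inj₂ w∈) rewrite segment-down {k} {c} s≤s' = subst (λ x → InColumn k c s x _) top (columnDown-∈ k c s _ w∈)

  column-segment-uses : ∀ y y' →
    uses (segment (k , c , s) (k , c , s')) y y' ≡ true ⊎ uses (segment (k , c , s') (k , c , s)) y y' ≡ true →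
    ColumnEdge k c s s' y y'
  column-segment-uses y y' (inj₁ e) rewrite segment-up {k} {c} s≤s' =
    subst (λ x → ColumnEdge k c s x y y') top (columnUp-uses k c s _ y y' e)
  column-segment-uses y y' (inj₂ e) rewrite segment-down {k} {c} s≤s' =
    subst (λ x → ColumnEdge k c s x y y') top (columnDown-uses k c s _ y y' e)

  column-segment-paths : ∀ f → (∀ t → s ≤ t → t ≤ s' → YVert f (k , c , t)) →
    YPath f (k , c , s) (k , c , s') (segment (k , c , s) (k , c , s')) ×
    YPath f (k , c , s') (k , c , s) (segment (k , c , s') (k , c , s))
  column-segment-paths f inY rewrite segment-up {k} {c} s≤s' | segment-down {k} {c} s≤s' =
    subst (λ x → YPath f (k , c , s) (k , c , x) (columnUp k c s (s' ∸ s))) top (columnUp-path f k c s _ inY') ,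
    subst (λ x → YPath f (k , c , x) (k , c , s) (columnDown k c s (s' ∸ s))) top (columnDown-path f k c s _ inY')
    where
    inY' : ∀ t → s ≤ t → t ≤ s + (s' ∸ s) → YVert f (k , c , t)
    inY' t s≤t t≤ = inY t s≤t (subst (t ≤_) top t≤)

level-segment-ends : ∀ {k c c' s w} →
  w ∈ segment (k , c , s) (k , c' , s) ⊎ w ∈ segment (k , c' , s) (k , c , s) → w ≡ (k , c , s) ⊎ w ≡ (k , c' , s)
level-segment-ends {k} {c} {c'} {s} {w} w∈ = by-columns (c ≟ c')
  where
  by-columns : Dec (c ≡ c') → w ≡ (k , c , s) ⊎ w ≡ (k , c' , s)
  by-columns (yes refl) with column-segment-∈ {k} {c} ≤-refl w∈
  ... | t , s≤t , t≤s , refl = inj₁ (cong (λ t → k , c , t) (≤-antisym t≤s s≤t))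
  by-columns (no c≢c') = ends w∈
    where
    ends : w ∈ segment (k , c , s) (k , c' , s) ⊎ w ∈ segment (k , c' , s) (k , c , s) → w ≡ (k , c , s) ⊎ w ≡ (k , c' , s)
    ends (inj₁ w∈) with subst (w ∈_) (segment-across c≢c') w∈
    ... | here w≡         = inj₁ w≡
    ... | there (here w≡) = inj₂ w≡
    ends (inj₂ w∈) with subst (w ∈_) (segment-across (≢-sym c≢c')) w∈
    ... | here w≡         = inj₂ w≡
    ... | there (here w≡) = inj₁ w≡

-- The wiring

residue : ℕ → ℕ → ℕ
residue k j = _%_ j (LX k) {{LX-nonZero k}}

-- Component n is folded onto column 0 of Y_n, its column surviving as the layer.  Every other
-- component keeps its columns while ψ k stretches its heights, sending rungs to multiples of
-- period k, which is LY k for k ≠ n.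
module Wiring (f : ℕ → ℕ) (n r : ℕ) (r-fits : suc r < LX (suc n)) where

  -- Opaque, so that case splits on k ≟ n (for column and layer) do not rewrite inside ψ.
  opaque
    jumpLength : ℕ → ℕ
    jumpLength k with k ≟ n
    ... | yes _ = 0
    ... | no _  = LY k ∸ LX k

    jumpResidue : ℕ → ℕ
    jumpResidue k with n <? k
    ... | yes _ = r
    ... | no _  = 0

  module S (k : ℕ) = Stretch (LX k) {{LX-nonZero k}} (jumpLength k) (jumpResidue k)

  ψ : ℕ → ℕ → ℕ
  ψ = S.stretch

  period : ℕ → ℕ
  period k = LX k + jumpLength k

  column : ℕ → ℕ → ℕ
  column k i with k ≟ n
  ... | yes _ = 0
  ... | no _  = i

  layer : ℕ → ℕ → ℕ
  layer k i with k ≟ n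
  ... | yes _ = i
  ... | no _  = 0

  layerOf : Vert → ℕ
  layerOf (k , i , _) = layer k i

  wire : Vert → Vert
  wire (k , i , j) = k , column k i , ψ k j

  column-+-layer : ∀ k i → column k i + layer k i ≡ i
  column-+-layer k i with k ≟ n
  ... | yes _ = refl
  ... | no _  = +-identityʳ i

  column-< : ∀ {k i j} → XVert f (k , i , j) → column k i < f k
  column-< {k} {i} (_ , i<f , _) with k ≟ n
  ... | yes _ = ≤-<-trans z≤n i<f
  ... | no _  = i<f

  column-self : ∀ i → column n i ≡ 0
  column-self i with n ≟ n
  ... | yes _   = refl
  ... | no n≢n  = ⊥-elim (n≢n refl)

  layer-< : 1 ≤ f n → ∀ {k i j} → XVert f (k , i , j) → layer k i < f n
  layer-< 1≤fn {k} {i} (_ , i<f , _) with k ≟ n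
  ... | yes refl = i<f
  ... | no _     = 1≤fn

  opaque
    unfolding jumpLength jumpResidue
    period-≤ : ∀ k → period k ≤ LY k
    period-≤ k with k ≟ n
    ... | yes _ = ≤-trans (≤-reflexive (+-identityʳ (LX k))) (LX≤LY k)
    ... | no _  = ≤-reflexive (m+[n∸m]≡n (LX≤LY k))

    period-self : period n ≡ LX n
    period-self with n ≟ n
    ... | yes _   = +-identityʳ (LX n)
    ... | no n≢n  = ⊥-elim (n≢n refl)

    period-other : ∀ {k} → k ≢ n → period k ≡ LY k
    period-other {k} k≢n with k ≟ n
    ... | yes k≡n = ⊥-elim (k≢n k≡n)
    ... | no _    = m+[n∸m]≡n (LX≤LY k)

    residue-fits : ∀ k → suc (jumpResidue k) < LX k
    residue-fits k with n <? k
    ... | yes n<k = <-≤-trans r-fits (LX-mono-≤ n<k)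
    ... | no _    = 2≤LX k

    jumpResidue-above : ∀ {k} → n < k → jumpResidue k ≡ r
    jumpResidue-above {k} n<k with n <? k
    ... | yes _   = refl
    ... | no n≮k  = ⊥-elim (n≮k n<k)

  ψ-multiple : ∀ k q → ψ k (q * LX k) ≡ q * period k
  ψ-multiple k = S.stretch-multiple k (residue-fits k)

  ψ-bound : ∀ k j → j ≤ LX k * f k → ψ k j ≤ period k * f k
  ψ-bound k j j≤ = begin
    ψ k j                  ≤⟨ S.stretch-mono-≤ k (≤-trans j≤ (≤-reflexive (*-comm (LX k) (f k)))) ⟩
    ψ k (f k * LX k)       ≡⟨ ψ-multiple k (f k) ⟩
    f k * period k         ≡⟨ *-comm (f k) (period k) ⟩
    period k * f k         ∎
    where open ≤-Reasoning

  ψ-short : ∀ {k} j → n < k → residue k (suc j) ≢ suc r → ψ k (suc j) ≡ suc (ψ k j)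
  ψ-short {k} j n<k res≢ =
    S.stretch-short k j (subst (λ x → residue k (suc j) ≢ suc x) (sym (jumpResidue-above n<k)) res≢)

  run-YVert : ∀ {k i j c t} → XVert f (k , i , j) → c < f k → t ≤ ψ k j → YVert f (k , c , t)
  run-YVert {k} {j = j} (1≤k , _ , j≤) c<f t≤ =
    1≤k , c<f , ≤-trans t≤ (≤-trans (ψ-bound k j j≤) (*-monoˡ-≤ (f k) (period-≤ k)))

  wire-YVert : ∀ {u} → XVert f u → YVert f (wire u)
  wire-YVert u∈X = run-YVert u∈X (column-< u∈X) ≤-refl

  column-layer-injective : ∀ {k i i'} → column k i ≡ column k i' → layer k i ≡ layer k i' → i ≡ i'
  column-layer-injective {k} {i} {i'} same-column same-layer =
    trans (sym (column-+-layer k i)) (trans (cong₂ _+_ same-column same-layer) (column-+-layer k i'))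

  wire-layer-injective : ∀ {u v} → wire u ≡ wire v → layerOf u ≡ layerOf v → u ≡ v
  wire-layer-injective {k , i , j} {k' , i' , j'} same-wire same-layer
    with triple-injective same-wire
  ... | refl , same-column , same-height =
    cong₂ (λ i j → k , i , j) (column-layer-injective same-column same-layer) (S.stretch-injective k same-height)

  ψ-divisible : ∀ {k j} → k ≢ n → LX k ∣ j → LY k ∣ ψ k j
  ψ-divisible {k} k≢n (divides q refl) = divides q (trans (ψ-multiple k q) (cong (q *_) (period-other k≢n)))

  step-paths : ∀ {u v} → Step f LX u v →
    YPath f (wire u) (wire v) (segment (wire u) (wire v)) × YPath f (wire v) (wire u) (segment (wire v) (wire u))
  step-paths {k , i , j} (_ , v∈X , refl , inj₁ (refl , refl)) =
    column-segment-paths (<⇒≤ (S.stretch-<-suc k j)) f λ t _ t≤ → run-YVert v∈X (column-< v∈X) t≤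
  step-paths {k , i , j} (u∈X@(_ , i<f , _) , v∈X@(_ , 1+i<f , _) , refl , inj₂ (refl , refl , LX∣j)) with k ≟ n
  ... | yes _ = column-segment-paths ≤-refl f λ t _ t≤ → run-YVert u∈X (≤-<-trans z≤n i<f) t≤
  ... | no k≢n
    rewrite segment-across {k} {i} {ψ k j} {k} {suc i} {ψ k j} (≢-sym 1+n≢n)
          | segment-across {k} {suc i} {ψ k j} {k} {i} {ψ k j} 1+n≢n =
    step (inj₁ across) (single (run-YVert v∈X 1+i<f ≤-refl)) , step (inj₂ across) (single (run-YVert u∈X i<f ≤-refl))
    where
    across : Step f LY (k , i , ψ k j) (k , suc i , ψ k j)
    across = run-YVert u∈X i<f ≤-refl , run-YVert v∈X 1+i<f ≤-refl , refl , inj₂ (refl , refl , ψ-divisible k≢n LX∣j)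

  data Covers : Vert → Vert → Vert → Vert → Set where
    vertical   : ∀ {k i j y y'} → ColumnEdge k (column k i) (ψ k j) (ψ k (suc j)) y y' →
                 Covers (k , i , j) (k , i , suc j) y y'
    horizontal : ∀ {k i j y y'} → k ≢ n → SamePair (k , i , ψ k j) (k , suc i , ψ k j) y y' →
                 Covers (k , i , j) (k , suc i , j) y y'

  step-covers : ∀ {u v} → Step f LX u v → ∀ y y' →
    uses (segment (wire u) (wire v)) y y' ≡ true ⊎ uses (segment (wire v) (wire u)) y y' ≡ true →
    Covers u v y y'
  step-covers {k , i , j} (_ , _ , refl , inj₁ (refl , refl)) y y' e =
    vertical (column-segment-uses (<⇒≤ (S.stretch-<-suc k j)) y y' e)
  step-covers {k , i , j} (_ , _ , refl , inj₂ (refl , refl , _)) y y' e with k ≟ n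
  ... | yes _ with column-segment-uses {k} {0} {ψ k j} ≤-refl y y' e
  ...   | t , s≤t , t<s , _ = ⊥-elim (<-irrefl refl (<-≤-trans t<s s≤t))
  step-covers {k , i , j} (_ , _ , refl , inj₂ (refl , refl , _)) y y' e | no k≢n = horizontal k≢n (pair e)
    where
    pair : uses (segment (k , i , ψ k j) (k , suc i , ψ k j)) y y' ≡ true ⊎
           uses (segment (k , suc i , ψ k j) (k , i , ψ k j)) y y' ≡ true →
           SamePair (k , i , ψ k j) (k , suc i , ψ k j) y y'
    pair (inj₁ e) = uses-pair _ _ y y' (subst (λ ps → uses ps y y' ≡ true) (segment-across {k} {i} {ψ k j} {k} (≢-sym 1+n≢n)) e)
    pair (inj₂ e) = SamePair-swap (uses-pair _ _ y y' (subst (λ ps → uses ps y y' ≡ true) (segment-across {k} {suc i} {ψ k j} {k} 1+n≢n) e))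

  covers-unique : ∀ {u v u' v' y y'} → Covers u v y y' → Covers u' v' y y' → layerOf u ≡ layerOf u' →
    u ≡ u' × v ≡ v'
  covers-unique {k , i , j} {u' = _ , i' , j'} (vertical (_ , lo , hi , p)) (vertical (_ , lo' , hi' , p')) same-layer
    with triple-injective (vertical-edges-agree (SamePair-match p p'))
  ... | refl , same-column , refl
    with column-layer-injective {k} {i} {i'} same-column same-layer | S.stretch-interval-unique k lo hi lo' hi'
  ... | refl | refl = refl , refl
  covers-unique (vertical (_ , _ , _ , p)) (horizontal _ p') _ = ⊥-elim (vertical≢horizontal (SamePair-match p p'))
  covers-unique (horizontal _ p) (vertical (_ , _ , _ , p')) _ = ⊥-elim (vertical≢horizontal (SamePair-match p' p))
  covers-unique {k , i , j} {u' = _ , _ , j'} (horizontal _ p) (horizontal _ p') _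
    with triple-injective (horizontal-edges-agree (SamePair-match p p'))
  ... | refl , refl , same-height with S.stretch-injective k {j} {j'} same-height
  ... | refl = refl , refl

  covers-layer : ∀ {u v y y'} → Covers u v y y' → layerOf v ≡ layerOf u
  covers-layer (vertical _) = refl
  covers-layer {k , i , _} (horizontal k≢n _) with k ≟ n
  ... | yes k≡n = ⊥-elim (k≢n k≡n)
  ... | no _    = refl

  covers-layer-end : ∀ {u v x x' y y'} → Covers u v y y' → SamePair u v x x' → layerOf x ≡ layerOf u
  covers-layer-end _   (inj₁ (refl , _)) = refl
  covers-layer-end cov (inj₂ (_ , refl)) = covers-layer cov

  covered-edges-agree : ∀ {u v u' v' x x' z z' y y'} → Covers u v y y' → Covers u' v' y y' →
    SamePair u v x x' → SamePair u' v' z z' → layerOf x ≡ layerOf z → SamePair x x' z z'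
  covered-edges-agree cov cov' uv uv' same-layer
    with covers-unique cov cov' (trans (sym (covers-layer-end cov uv)) (trans same-layer (covers-layer-end cov' uv')))
  ... | refl , refl = SamePair-match (SamePair-sym uv) (SamePair-sym uv')

  adj-paths : ∀ {u v} → XAdj f u v → YPath f (wire u) (wire v) (segment (wire u) (wire v))
  adj-paths (inj₁ uv) = proj₁ (step-paths uv)
  adj-paths (inj₂ vu) = proj₂ (step-paths vu)

  adj-covers : ∀ {u v y y'} → XAdj f u v → uses (segment (wire u) (wire v)) y y' ≡ true →
    ∃[ u' ] ∃[ v' ] Covers u' v' y y' × SamePair u' v' u v
  adj-covers {u} {v} {y} {y'} (inj₁ uv) used = u , v , step-covers uv y y' (inj₁ used) , inj₁ (refl , refl)
  adj-covers {u} {v} {y} {y'} (inj₂ vu) used = v , u , step-covers vu y y' (inj₂ used) , inj₂ (refl , refl)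

-- Wiring a finite subgraph of X

module WiredSubgraph (f : ℕ → ℕ) (adm : Admissible f) (n : ℕ) (2≤n : 2 ≤ n)
                     {m : ℕ} (m≤ : m ≤ sizeX f n) (Γ : Subgraph f m) where

  open Subgraph Γ
  open Admissible adm

  f≤id : ∀ {k} → 1 ≤ k → f k ≤ k
  f≤id {suc zero}    _ = ≤-reflexive f1
  f≤id {suc (suc k)} _ = proj₂ (bounds (suc (suc k)) (s≤s (s≤s z≤n)))

  2≤fn : 2 ≤ f n
  2≤fn = proj₁ (bounds n 2≤n)

  1≤n : 1 ≤ n
  1≤n = ≤-trans (s≤s z≤n) 2≤n

  1≤fn : 1 ≤ f n
  1≤fn = ≤-trans (s≤s z≤n) 2≤fn

  residueOf : Vert → ℕ
  residueOf (k , _ , j) = residue k j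

  -- Through pred, the value r found is such that no vertex of Γ has residue suc r.  Opaque, since
  -- unfolding the pigeonhole search while typechecking the wiring is prohibitively expensive.
  opaque
    free-residue : ∃[ r ] r ≤ m × ∀ a → pred (residueOf (ι a)) ≢ r
    free-residue = missing-value λ a → pred (residueOf (ι a))

  r : ℕ
  r = proj₁ free-residue

  r-fits : suc r < LX (suc n)
  r-fits = ≤-<-trans (s≤s (proj₁ (proj₂ free-residue))) (room-for-residue f n m (f≤id 1≤n) m≤)

  avoids : ∀ {a k i j} → ι a ≡ (k , i , j) → residue k j ≢ suc r
  avoids {a} refl res≡ = proj₂ (proj₂ free-residue) a (cong pred res≡)

  open Wiring f n r r-fits

  g : Fin m → Vert
  g a = wire (ι a)

  P : Fin m → Fin m → List Vert
  P a b = segment (g a) (g b)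

  g-Y : ∀ a → YVert f (g a)
  g-Y a = wire-YVert {ι a} (ι-X a)

  P-path : ∀ a b → IsEdge E a b ≡ true → YPath f (g a) (g b) (P a b)
  P-path a b e = adj-paths (E-X a b e)

  vertex-coarse : ∀ y → YVert f y → countᵇ (λ a → g a ==V y) (allFin m) ≤ f n
  vertex-coarse y _ = countᵇ-≤-injection _ (λ a → layerOf (ι a)) (f n) (allFin⁺ m)
    (λ a _ → layer-< 1≤fn (ι-X a))
    λ a b ga≡y gb≡y same-layer →
      ι-inj a b (wire-layer-injective (trans (==V-sound (g a) y ga≡y) (sym (==V-sound (g b) y gb≡y))) same-layer)

  edge-covers : ∀ {a b y y'} → IsEdge E a b ≡ true → uses (P a b) y y' ≡ true →
    ∃[ u ] ∃[ v ] Covers u v y y' × SamePair u v (ι a) (ι b)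
  edge-covers {a} {b} e = adj-covers (E-X a b e)

  edge-ordered : ∀ {a b} → IsEdge E a b ≡ true → toℕ a < toℕ b
  edge-ordered {a} {b} e = <ᵇ⇒< (toℕ a) (toℕ b) (subst T (sym (∧-conicalˡ (toℕ a <ᵇ toℕ b) _ e)) _)

  endpoints-unique : ∀ {a b a' b'} → toℕ a < toℕ b → toℕ a' < toℕ b' →
    SamePair (ι a) (ι b) (ι a') (ι b') → a ≡ a' × b ≡ b'
  endpoints-unique {a} {b} {a'} {b'} _ _ (inj₁ (same , same')) = ι-inj a a' same , ι-inj b b' same'
  endpoints-unique {a} {b} {a'} {b'} a<b a'<b' (inj₂ (same , same'))
    with ι-inj a b' same | ι-inj b a' same'
  ... | refl | refl = ⊥-elim (<-asym a<b a'<b')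

  edge-coarse : ∀ y y' → YAdj f y y' →
    sum (map (λ a → countᵇ (λ b → IsEdge E a b ∧ uses (P a b) y y') (allFin m)) (allFin m)) ≤ f n
  edge-coarse y y' _ = ≤-trans
    (≤-reflexive (sum-countᵇ≡countᵇ-cartesianProduct (λ a b → IsEdge E a b ∧ uses (P a b) y y') (allFin m) (allFin m)))
    (countᵇ-≤-injection _ (λ (a , _) → layerOf (ι a)) (f n) (cartesianProduct⁺ (allFin⁺ m) (allFin⁺ m))
      (λ (a , _) _ → layer-< 1≤fn (ι-X a))
      injective)
    where
    injective : ∀ ((a , b) (a' , b') : Fin m × Fin m) →
      IsEdge E a b ∧ uses (P a b) y y' ≡ true → IsEdge E a' b' ∧ uses (P a' b') y y' ≡ true →
      layerOf (ι a) ≡ layerOf (ι a') → (a , b) ≡ (a' , b')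
    injective (a , b) (a' , b') q q' same-layer =
      agree (edge-covers e (∧-conicalʳ (IsEdge E a b) _ q)) (edge-covers e' (∧-conicalʳ (IsEdge E a' b') _ q'))
      where
      e : IsEdge E a b ≡ true
      e = ∧-conicalˡ (IsEdge E a b) _ q
      e' : IsEdge E a' b' ≡ true
      e' = ∧-conicalˡ (IsEdge E a' b') _ q'
      agree : ∃[ u ] ∃[ v ] Covers u v y y' × SamePair u v (ι a) (ι b) →
              ∃[ u ] ∃[ v ] Covers u v y y' × SamePair u v (ι a') (ι b') → (a , b) ≡ (a' , b')
      agree (_ , _ , cov , uv) (_ , _ , cov' , uv') =
        uncurry (cong₂ _,_) (endpoints-unique (edge-ordered e) (edge-ordered e') (covered-edges-agree cov cov' uv uv' same-layer))

  lowerComponents : List Vert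
  lowerComponents = cartesianProduct (upTo n) (cartesianProduct (upTo n) (upTo (suc (LY (pred n) * n))))

  foldedAt : ℕ → Vert
  foldedAt t = n , 0 , t

  foldedColumn : List Vert
  foldedColumn = map foldedAt (upTo (LX n * f n + 1))

  image : List Vert
  image = lowerComponents ++ (foldedColumn ++ map g (allFin m))

  g-image : ∀ a → g a ∈ image
  g-image a = ∈-++⁺ʳ lowerComponents (∈-++⁺ʳ foldedColumn (∈-map⁺ g (∈-allFin a)))

  lower-image : ∀ {k c t} → k < n → c < n → t ≤ LY (pred n) * n → (k , c , t) ∈ image
  lower-image k<n c<n t≤ =
    ∈-++⁺ˡ (∈-cartesianProduct⁺ (∈-upTo⁺ k<n) (∈-cartesianProduct⁺ (∈-upTo⁺ c<n) (∈-upTo⁺ (s≤s t≤))))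

  folded-image : ∀ {t} → t ≤ LX n * f n → (n , 0 , t) ∈ image
  folded-image {t} t≤ = ∈-++⁺ʳ lowerComponents (∈-++⁺ˡ (∈-map⁺ foldedAt
    (∈-upTo⁺ (subst (t <_) (+-comm 1 (LX n * f n)) (s≤s t≤)))))

  wired-image : ∀ {a u} → ι a ≡ u → wire u ∈ image
  wired-image {a} refl = g-image a

  lower-run-image : ∀ {k i j t} → k < n → XVert f (k , i , suc j) → t ≤ ψ k (suc j) → (k , column k i , t) ∈ image
  lower-run-image {k} {i} {j} {t} k<n v∈X@(1≤k , _ , j≤) t≤ = lower-image k<n (<-≤-trans (column-< v∈X) fk≤n) (begin
    t                     ≤⟨ t≤ ⟩
    ψ k (suc j)           ≤⟨ ψ-bound k (suc j) j≤ ⟩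
    period k * f k        ≤⟨ *-mono-≤ (≤-trans (period-≤ k) (LY-mono-≤ k≤pred-n)) fk≤n ⟩
    LY (pred n) * n       ∎)
    where
    open ≤-Reasoning
    fk≤n : f k ≤ n
    fk≤n = ≤-trans (f≤id 1≤k) (<⇒≤ k<n)
    k≤pred-n : k ≤ pred n
    k≤pred-n = ≤-pred (≤-trans k<n (≤-reflexive (sym (suc-pred n {{>-nonZero 1≤n}}))))

  folded-run-image : ∀ {i j t} → XVert f (n , i , suc j) → t ≤ ψ n (suc j) → (n , column n i , t) ∈ image
  folded-run-image {i} {j} {t} (_ , _ , j≤) t≤ = subst (λ c → (n , c , t) ∈ image) (sym (column-self i))
    (folded-image (≤-trans t≤ (≤-trans (ψ-bound n (suc j) j≤) (≤-reflexive (cong (_* f n) period-self)))))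

  upper-run-image : ∀ {a b k i j t} → n < k → ι a ≡ (k , i , j) → ι b ≡ (k , i , suc j) →
    ψ k j ≤ t → t ≤ ψ k (suc j) → (k , column k i , t) ∈ image
  upper-run-image {k = k} {i} {j} {t} n<k ιa ιb lo hi = by-height (m≤n⇒m<n∨m≡n (subst (t ≤_) short hi))
    where
    short : ψ k (suc j) ≡ suc (ψ k j)
    short = ψ-short j n<k (avoids ιb)
    by-height : t < suc (ψ k j) ⊎ t ≡ suc (ψ k j) → (k , column k i , t) ∈ image
    by-height (inj₁ t<)   = subst (λ t → (k , column k i , t) ∈ image) (≤-antisym lo (≤-pred t<)) (wired-image ιa)
    by-height (inj₂ refl) = subst (λ t → (k , column k i , t) ∈ image) short (wired-image ιb)

  vertical-run-image : ∀ {a b k i j w} → ι a ≡ (k , i , j) → ι b ≡ (k , i , suc j) → XVert f (k , i , suc j) →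
    InColumn k (column k i) (ψ k j) (ψ k (suc j)) w → w ∈ image
  vertical-run-image {a} {b} {k} {i} {j} ιa ιb v∈X (t , lo , hi , refl) = by-component (<-cmp k n)
    where
    by-component : Tri (k < n) (k ≡ n) (n < k) → (k , column k i , t) ∈ image
    by-component (tri< k<n _ _) = lower-run-image k<n v∈X hi
    by-component (tri≈ _ refl _) = folded-run-image v∈X hi
    by-component (tri> _ _ n<k) = upper-run-image n<k ιa ιb lo hi

  step-image : ∀ {a b u v w} → ι a ≡ u → ι b ≡ v → Step f LX u v →
    w ∈ segment (wire u) (wire v) ⊎ w ∈ segment (wire v) (wire u) → w ∈ image
  step-image {u = k , i , j} ιa ιb (_ , v∈X , refl , inj₁ (refl , refl)) w∈ =
    vertical-run-image ιa ιb v∈X (column-segment-∈ (<⇒≤ (S.stretch-<-suc k j)) w∈)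
  step-image {u = k , i , j} ιa ιb (_ , _ , refl , inj₂ (refl , refl , _)) w∈ =
    [ (λ w≡ → subst (_∈ image) (sym w≡) (wired-image ιa)) , (λ w≡ → subst (_∈ image) (sym w≡) (wired-image ιb)) ]′
    (level-segment-ends {k} {column k i} {column k (suc i)} {ψ k j} w∈)

  adj-image : ∀ {a b w} → XAdj f (ι a) (ι b) → w ∈ segment (wire (ι a)) (wire (ι b)) → w ∈ image
  adj-image (inj₁ ab) w∈ = step-image refl refl ab (inj₁ w∈)
  adj-image (inj₂ ba) w∈ = step-image refl refl ba (inj₂ w∈)

  P-image : ∀ a b → IsEdge E a b ≡ true → ∀ w → w ∈ P a b → w ∈ image
  P-image a b e w = adj-image (E-X a b e)

  length-image : length image ≡ n * (n * suc (LY (pred n) * n)) + ((LX n * f n + 1) + m)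
  length-image = begin
    length image
      ≡⟨ trans (length-++ lowerComponents) (cong (length lowerComponents +_) (length-++ foldedColumn)) ⟩
    length lowerComponents + (length foldedColumn + length (map g (allFin m)))
      ≡⟨ cong₂ _+_ lower-length (cong₂ _+_ folded-length wired-length) ⟩
    n * (n * suc (LY (pred n) * n)) + ((LX n * f n + 1) + m) ∎
    where
    open ≡-Reasoning
    lower-length : length lowerComponents ≡ n * (n * suc (LY (pred n) * n))
    lower-length = trans (length-cartesianProduct (upTo n) _)
      (cong₂ _*_ (length-upTo n) (trans (length-cartesianProduct (upTo n) (upTo _)) (cong₂ _*_ (length-upTo n) (length-upTo _))))
    folded-length : length foldedColumn ≡ LX n * f n + 1
    folded-length = trans (length-map foldedAt (upTo (LX n * f n + 1))) (length-upTo (LX n * f n + 1))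
    wired-length : length (map g (allFin m)) ≡ m
    wired-length = trans (length-map g (allFin m)) (length-tabulate {n = m} id)

  image-length : length image ≤ 2 * sizeX f n
  image-length = begin
    length image                                              ≡⟨ length-image ⟩
    n * (n * suc (LY (pred n) * n)) + ((LX n * f n + 1) + m)
      ≤⟨ volume-≤ _ _ (f n) m (≤-trans (lower-volume≤ n (f n) 1≤n 2≤fn) (m≤m+n _ 1)) m≤ 2≤fn ⟩
    2 * sizeX f n                                             ∎
    where open ≤-Reasoning

mainTheorem4 : (f : ℕ → ℕ) → Admissible f → (n : ℕ) → 2 ≤ n →
    ∀ (m : ℕ) → m ≤ sizeX f n → (Γ : Subgraph f m) →
    CoarseWiring f Γ (f n) (2 * sizeX f n)
mainTheorem4 f adm n 2≤n m m≤ Γ = record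
  { g = g ; P = P ; g-Y = g-Y ; P-path = P-path
  ; vertex-coarse = vertex-coarse ; edge-coarse = edge-coarse
  ; image = image ; image-length = image-length ; g-image = g-image ; P-image = P-image }
  where open WiredSubgraph f adm n 2≤n m≤ Γ
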